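{- Let $T$ be a tournament and $R=\{a,b,c\}\subseteq V(T)$ a set of three vertices. Then $R$ is a minimal $\tau$-retentive set of $T$ if and only if (1) $T[R]$ is a directed triangle, and (2) no vertex of $T$ dominates two vertices of $R$.
   Context: A tournament $T$ consists of a finite vertex set $V(T)$ and an asymmetric, complete binary relation $\succ$ on $V(T)$ ($x$ dominates $y$ if $x\succ y$). For $v\in V(T)$ let $N^-_T(v)=\{u: u\succ v\}$; for $B\subseteq V(T)$, $T[B]$ is the induced subtournament. A directed triangle is a tournament on three vertices in which each vertex has exactly one in-neighbor. The tournament equilibrium set $\tau$ is defined recursively: a nonempty $A\subseteq V(T)$ is $\tau$-retentive if for every $x\in A$ with $N^-_T(x)\neq\emptyset$, $\tau(T[N^-_T(x)])\subseteq A$; $A$ is a minimal $\tau$-retentive set if no $\tau$-retentive set of $T$ is a proper subset of $A$; $\tau(T)$ is the union of all minimal $\tau$-retentive sets of $T$. -}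

module Defs where

open import Data.Nat using (ℕ; zero; suc)
open import Data.Bool using (Bool; true; false; _∧_)
open import Data.Fin using (Fin)
open import Data.Vec using (lookup; tabulate)
open import Data.Fin.Subset using (Subset; _∈_; _∉_; _⊆_; _⊂_; Nonempty; ∣_∣; ⊤)
open import Data.Product using (Σ; ∃; _×_)
open import Data.Empty using (⊥)
open import Relation.Nullary using (¬_)
open import Relation.Binary.PropositionalEquality using (_≡_; _≢_)
open import Data.Sum using (_⊎_)

-- A tournament on the vertex set Fin n: dom x y ≡ true means x ≻ y.
record Tournament (n : ℕ) : Set where
  field
    dom      : Fin n → Fin n → Bool
    asym     : ∀ x y → dom x y ≡ true → dom y x ≡ false
    complete : ∀ x y → x ≢ y → dom x y ≡ true ⊎ dom y x ≡ true

module _ {n : ℕ} (T : Tournament n) where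
  open Tournament T

  _≻_ : Fin n → Fin n → Set
  x ≻ y = dom x y ≡ true

  inNbr : Subset n → Fin n → Subset n
  inNbr B x = tabulate (λ u → lookup B u ∧ dom u x)

  -- τ with fuel: TauF k B v  means  v ∈ τ(T[B]) (exact whenever ∣ B ∣ ≤ k).
  mutual
    TauF : ℕ → Subset n → Fin n → Set
    TauF zero    B v = ⊥
    TauF (suc k) B v = ∃ λ A → MinRetF k B A × v ∈ A

    RetF : ℕ → Subset n → Subset n → Set
    RetF k B A = A ⊆ B × Nonempty A ×
      (∀ x → x ∈ A → Nonempty (inNbr B x) → ∀ y → TauF k (inNbr B x) y → y ∈ A)

    MinRetF : ℕ → Subset n → Subset n → Set
    MinRetF k B A = RetF k B A × (∀ A′ → RetF k B A′ → ¬ (A′ ⊂ A))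

  -- τ-retentive / minimal τ-retentive sets of T itself (fuel n suffices,
  -- since every in-neighbourhood has at most n - 1 vertices).
  Retentive : Subset n → Set
  Retentive = RetF n ⊤

  MinRetentive : Subset n → Set
  MinRetentive = MinRetF n ⊤

  DirectedTriangle : Subset n → Set
  DirectedTriangle R = ∣ R ∣ ≡ 3 × (∀ v → v ∈ R → ∣ inNbr R v ∣ ≡ 1)

  DominatesTwo : Fin n → Subset n → Set
  DominatesTwo v R = Σ (Fin n) λ u → Σ (Fin n) λ w →
    u ≢ w × u ∈ R × w ∈ R × v ≻ u × v ≻ w

-- A retentive set containing a vertex x without in-neighbour inside it shrinks to the
-- retentive singleton {x}.  Hence every vertex of a minimal τ-retentive three-set R has
-- an in-neighbour in R, which forces T[R] to be a directed triangle.  For a directed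
-- triangle everything rests on one fact and its converse: τ of a tournament with a
-- Condorcet winner p is {p}.  If u is the in-neighbour of w in R, retentiveness of R
-- gives τ(T[N⁻(w)]) ⊆ R ∩ N⁻(w) = {u}, so u beats all of N⁻(w) and no vertex dominates
-- both u and w.  Conversely, without such a vertex τ(T[N⁻(w)]) = {u} for every w ∈ R, so
-- R is retentive, and a retentive subset of R is closed under taking in-neighbours in R,
-- hence all of R.

module Submission where

open import Defs renaming (_≻_ to _⊢_≻_)
open import Data.Nat using (ℕ; zero; suc; _≤_; z≤n; s≤s)
open import Data.Nat.Properties using (≤-trans; 1+n≢0)
open import Data.Bool using (true; _∧_)
open import Data.Bool.Properties using (∧-conicalˡ; ∧-conicalʳ)
open import Data.Fin using (Fin; zero; suc)
open import Data.Fin.Properties using (_≟_)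
open import Data.Fin.Subset
  using (Subset; ⁅_⁆; _∪_; _∈_; _∉_; _⊆_; _⊂_; Nonempty; Empty; ∣_∣; ⊤; inside; outside)
open import Data.Fin.Subset.Properties
  using (x∈⁅x⁆; x∈⁅y⁆⇒x≡y; ∈⊤; x∈p∪q⁻; x∈p∪q⁺; ⊆-antisym; ∣⁅x⁆∣≡1; ∣⊥∣≡0;
         ∪-identityˡ; ∪-comm; ∪-assoc; nonempty?; Empty-unique)
open import Data.Fin.Subset.Induction using (Acc; acc; ⊂-wellFounded)
open import Data.Vec using (_∷_; lookup; here; there)
open import Data.Vec.Properties using ([]=⇒lookup; lookup⇒[]=; lookup∘tabulate)
open import Data.Product using (_×_; _,_; proj₁; proj₂; ∃)
open import Data.Sum using (_⊎_; inj₁; inj₂)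
open import Data.Empty using (⊥-elim)
open import Function.Base using (_∘_)
open import Function.Bundles using (_⇔_; mk⇔; Equivalence)
open import Relation.Nullary using (¬_; yes; no)
open import Relation.Binary.PropositionalEquality
  using (_≡_; _≢_; refl; sym; trans; cong; cong₂; subst)

i≢j⇒2≤n : ∀ {n} {i j : Fin n} → i ≢ j → 2 ≤ n
i≢j⇒2≤n {suc zero}    {zero} {zero} i≢j = ⊥-elim (i≢j refl)
i≢j⇒2≤n {suc (suc n)} _                 = s≤s (s≤s z≤n)

∣⁅x⁆∪p∣≡1+∣p∣ : ∀ {n} (x : Fin n) (p : Subset n) → x ∉ p → ∣ ⁅ x ⁆ ∪ p ∣ ≡ suc ∣ p ∣
∣⁅x⁆∪p∣≡1+∣p∣ zero    (outside ∷ p) _   = cong (suc ∘ ∣_∣) (∪-identityˡ p)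
∣⁅x⁆∪p∣≡1+∣p∣ zero    (inside ∷ p)  x∉p = ⊥-elim (x∉p here)
∣⁅x⁆∪p∣≡1+∣p∣ (suc x) (outside ∷ p) x∉p = ∣⁅x⁆∪p∣≡1+∣p∣ x p (x∉p ∘ there)
∣⁅x⁆∪p∣≡1+∣p∣ (suc x) (inside ∷ p)  x∉p = cong suc (∣⁅x⁆∪p∣≡1+∣p∣ x p (x∉p ∘ there))

module _ {n : ℕ} where

  private
    variable
      p : Subset n
      v w x y z : Fin n

  ∣p∣≢0⇒Nonempty : ∀ (p : Subset n) → ∣ p ∣ ≢ 0 → Nonempty p
  ∣p∣≢0⇒Nonempty p ∣p∣≢0 with nonempty? p
  ... | yes ne = ne
  ... | no ¬ne = ⊥-elim (∣p∣≢0 (trans (cong ∣_∣ (Empty-unique ¬ne)) (∣⊥∣≡0 n)))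

  ⁅x⁆⊂p : x ∈ p → y ∈ p → x ≢ y → ⁅ x ⁆ ⊂ p
  ⁅x⁆⊂p {x = x} {p = p} x∈p y∈p x≢y =
    (λ z∈⁅x⁆ → subst (_∈ p) (sym (x∈⁅y⁆⇒x≡y x z∈⁅x⁆)) x∈p) ,
    _ , y∈p , λ y∈⁅x⁆ → x≢y (sym (x∈⁅y⁆⇒x≡y x y∈⁅x⁆))

  Nonempty⇒¬⊂⁅x⁆ : Nonempty p → ¬ p ⊂ ⁅ x ⁆
  Nonempty⇒¬⊂⁅x⁆ {p = p} {x = x} (y , y∈p) (p⊆⁅x⁆ , z , z∈⁅x⁆ , z∉p) =
    z∉p (subst (_∈ p) (trans (x∈⁅y⁆⇒x≡y x (p⊆⁅x⁆ y∈p)) (sym (x∈⁅y⁆⇒x≡y x z∈⁅x⁆))) y∈p)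

  triple : Fin n → Fin n → Fin n → Subset n
  triple x y z = ⁅ x ⁆ ∪ ⁅ y ⁆ ∪ ⁅ z ⁆

  ∈triple⁻ : v ∈ triple x y z → v ≡ x ⊎ v ≡ y ⊎ v ≡ z
  ∈triple⁻ {x = x} {y} {z} v∈ with x∈p∪q⁻ ⁅ x ⁆ (⁅ y ⁆ ∪ ⁅ z ⁆) v∈
  ... | inj₁ v∈⁅x⁆ = inj₁ (x∈⁅y⁆⇒x≡y x v∈⁅x⁆)
  ... | inj₂ v∈⁅y,z⁆ with x∈p∪q⁻ ⁅ y ⁆ ⁅ z ⁆ v∈⁅y,z⁆
  ...   | inj₁ v∈⁅y⁆ = inj₂ (inj₁ (x∈⁅y⁆⇒x≡y y v∈⁅y⁆))
  ...   | inj₂ v∈⁅z⁆ = inj₂ (inj₂ (x∈⁅y⁆⇒x≡y z v∈⁅z⁆))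

  x∈triple : x ∈ triple x y z
  x∈triple = x∈p∪q⁺ (inj₁ (x∈⁅x⁆ _))

  y∈triple : y ∈ triple x y z
  y∈triple {x = x} = x∈p∪q⁺ {p = ⁅ x ⁆} (inj₂ (x∈p∪q⁺ (inj₁ (x∈⁅x⁆ _))))

  z∈triple : z ∈ triple x y z
  z∈triple {x = x} {y = y} = x∈p∪q⁺ {p = ⁅ x ⁆} (inj₂ (x∈p∪q⁺ {p = ⁅ y ⁆} (inj₂ (x∈⁅x⁆ _))))

  triple⊆ : x ∈ p → y ∈ p → z ∈ p → triple x y z ⊆ p
  triple⊆ {p = p} x∈p y∈p z∈p v∈ with ∈triple⁻ v∈
  ... | inj₁ refl        = x∈p
  ... | inj₂ (inj₁ refl) = y∈p
  ... | inj₂ (inj₂ refl) = z∈p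

  triple-rotate : triple x y z ≡ triple y z x
  triple-rotate {x = x} {y} {z} = trans (∪-comm ⁅ x ⁆ _) (∪-assoc ⁅ y ⁆ ⁅ z ⁆ ⁅ x ⁆)

  triple-swap : triple x y z ≡ triple x z y
  triple-swap {x = x} {y} {z} = cong (⁅ x ⁆ ∪_) (∪-comm ⁅ y ⁆ ⁅ z ⁆)

  ∣triple∣≡3 : x ≢ y → y ≢ z → x ≢ z → ∣ triple x y z ∣ ≡ 3
  ∣triple∣≡3 {x = x} {y} {z} x≢y y≢z x≢z =
    trans (∣⁅x⁆∪p∣≡1+∣p∣ x _ x∉⁅y,z⁆)
          (cong suc (trans (∣⁅x⁆∪p∣≡1+∣p∣ y _ (y≢z ∘ x∈⁅y⁆⇒x≡y z)) (cong suc (∣⁅x⁆∣≡1 z))))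
    where
    x∉⁅y,z⁆ : x ∉ ⁅ y ⁆ ∪ ⁅ z ⁆
    x∉⁅y,z⁆ x∈ with x∈p∪q⁻ ⁅ y ⁆ ⁅ z ⁆ x∈
    ... | inj₁ x∈⁅y⁆ = x≢y (x∈⁅y⁆⇒x≡y y x∈⁅y⁆)
    ... | inj₂ x∈⁅z⁆ = x≢z (x∈⁅y⁆⇒x≡y z x∈⁅z⁆)

  triple-other : x ≢ y → x ≢ z → v ∈ triple x y z → ∃ λ w → w ∈ triple x y z × v ≢ w
  triple-other x≢y x≢z v∈ with ∈triple⁻ v∈
  ... | inj₁ refl        = _ , y∈triple , x≢y
  ... | inj₂ (inj₁ refl) = _ , x∈triple , x≢y ∘ sym
  ... | inj₂ (inj₂ refl) = _ , x∈triple , x≢z ∘ sym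

module _ {n : ℕ} (T : Tournament n) where
  open Tournament T

  private
    variable
      k : ℕ
      A B : Subset n
      a b c p s t u v w x y : Fin n

  ≻-asym : T ⊢ x ≻ y → ¬ T ⊢ y ≻ x
  ≻-asym {x} {y} x≻y y≻x with trans (sym y≻x) (asym x y x≻y)
  ... | ()

  ≻-irrefl : ¬ T ⊢ x ≻ x
  ≻-irrefl x≻x = ≻-asym x≻x x≻x

  ≻⇒≢ : T ⊢ x ≻ y → x ≢ y
  ≻⇒≢ x≻y refl = ≻-irrefl x≻y

  ≻-third : u ∈ triple v s t → T ⊢ u ≻ v → T ⊢ v ≻ s → u ≡ t
  ≻-third u∈ u≻v v≻s with ∈triple⁻ u∈
  ... | inj₁ refl        = ⊥-elim (≻-irrefl u≻v)
  ... | inj₂ (inj₁ refl) = ⊥-elim (≻-asym v≻s u≻v)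
  ... | inj₂ (inj₂ refl) = refl

  ∈inNbr⁻ : u ∈ inNbr T B x → u ∈ B × T ⊢ u ≻ x
  ∈inNbr⁻ {u} {B} {x} u∈ = lookup⇒[]= u B (∧-conicalˡ _ _ u∈B∧u≻x) , ∧-conicalʳ _ _ u∈B∧u≻x
    where
    u∈B∧u≻x : lookup B u ∧ dom u x ≡ true
    u∈B∧u≻x = trans (sym (lookup∘tabulate _ u)) ([]=⇒lookup u∈)

  ∈inNbr⁺ : u ∈ B → T ⊢ u ≻ x → u ∈ inNbr T B x
  ∈inNbr⁺ {u} u∈B u≻x = lookup⇒[]= u _ (trans (lookup∘tabulate _ u) (cong₂ _∧_ ([]=⇒lookup u∈B) u≻x))

  inNbr⊆ : inNbr T B x ⊆ B
  inNbr⊆ = proj₁ ∘ ∈inNbr⁻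

  inNbr-mono : A ⊆ B → inNbr T A x ⊆ inNbr T B x
  inNbr-mono A⊆B u∈ = let (u∈A , u≻x) = ∈inNbr⁻ u∈ in ∈inNbr⁺ (A⊆B u∈A) u≻x

  inNbr≡⁅⁆⁺ : p ∈ A → T ⊢ p ≻ x → (∀ {u} → u ∈ A → T ⊢ u ≻ x → u ≡ p) → inNbr T A x ≡ ⁅ p ⁆
  inNbr≡⁅⁆⁺ {p} {A} {x} p∈A p≻x unique = ⊆-antisym
    (λ u∈ → let (u∈A , u≻x) = ∈inNbr⁻ u∈ in subst (_∈ ⁅ p ⁆) (sym (unique u∈A u≻x)) (x∈⁅x⁆ p))
    (λ u∈⁅p⁆ → subst (_∈ inNbr T A x) (sym (x∈⁅y⁆⇒x≡y p u∈⁅p⁆)) (∈inNbr⁺ p∈A p≻x))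

  inNbr≡⁅⁆⁻ : inNbr T A x ≡ ⁅ p ⁆ → p ∈ A × T ⊢ p ≻ x
  inNbr≡⁅⁆⁻ {p = p} eq = ∈inNbr⁻ (subst (p ∈_) (sym eq) (x∈⁅x⁆ p))

  τ⊆ : TauF T k B y → y ∈ B
  τ⊆ {suc k} (A , ((A⊆B , _) , _) , y∈A) = A⊆B y∈A

  CondorcetWinner : Subset n → Fin n → Set
  CondorcetWinner B p = p ∈ B × Empty (inNbr T B p)

  winner-⊆ : A ⊆ B → p ∈ A → CondorcetWinner B p → CondorcetWinner A p
  winner-⊆ A⊆B p∈A (_ , noIn) = p∈A , λ (u , u∈) → noIn (u , inNbr-mono A⊆B u∈)

  retentive-whole : Nonempty B → RetF T k B B
  retentive-whole ne = (λ v∈B → v∈B) , ne , λ _ _ _ _ t → inNbr⊆ (τ⊆ t)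

  retentive-source : RetF T k B A → x ∈ A → Empty (inNbr T A x) → RetF T k B ⁅ x ⁆
  retentive-source {k} {B} {A} {x} (A⊆B , _ , closed) x∈A noIn = ⁅x⁆⊆B , (x , x∈⁅x⁆ x) , closed′
    where
    ⁅x⁆⊆B : ⁅ x ⁆ ⊆ B
    ⁅x⁆⊆B z∈⁅x⁆ = A⊆B (subst (_∈ A) (sym (x∈⁅y⁆⇒x≡y x z∈⁅x⁆)) x∈A)
    closed′ : ∀ z → z ∈ ⁅ x ⁆ → Nonempty (inNbr T B z) → ∀ y → TauF T k (inNbr T B z) y → y ∈ ⁅ x ⁆
    closed′ z z∈⁅x⁆ ne y t with x∈⁅y⁆⇒x≡y x z∈⁅x⁆
    ... | refl = ⊥-elim (noIn (y , ∈inNbr⁺ (closed z x∈A ne y t) (proj₂ (∈inNbr⁻ {B = B} (τ⊆ t)))))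

  ¬¬minimal : Acc _⊂_ A → RetF T k B A → ¬ ¬ ∃ (MinRetF T k B)
  ¬¬minimal {A} (acc smaller) retA noMinimal =
    noMinimal (A , retA , λ A′ retA′ A′⊂A → ¬¬minimal (smaller A′⊂A) retA′ noMinimal)

  -- Minimal retentive sets exist only classically; every use below proves ⊥, so ¬¬ suffices.
  τ-nonempty : Nonempty B → ¬ ¬ ∃ (TauF T (suc k) B)
  τ-nonempty ne noτ = ¬¬minimal (⊂-wellFounded _) (retentive-whole ne)
    λ (A , minA@((_ , (y , y∈A) , _) , _)) → noτ (y , A , minA , y∈A)

  winner∈τ : 1 ≤ k → CondorcetWinner B p → TauF T k B p
  winner∈τ {suc k} {B} {p} (s≤s z≤n) (p∈B , noIn) = ⁅ p ⁆ , (ret⁅p⁆ , minimal) , x∈⁅x⁆ p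
    where
    ret⁅p⁆ : RetF T k B ⁅ p ⁆
    ret⁅p⁆ = retentive-source (retentive-whole (p , p∈B)) p∈B noIn
    minimal : ∀ A′ → RetF T k B A′ → ¬ A′ ⊂ ⁅ p ⁆
    minimal _ (_ , ne , _) = Nonempty⇒¬⊂⁅x⁆ ne

  -- Only two levels of the fuelled recursion are unfolded, so no bound on ∣ B ∣ is needed.
  τ⊆winner : 2 ≤ k → CondorcetWinner B p → TauF T k B y → y ≡ p
  τ⊆winner {suc (suc k)} {B} {p} {y} (s≤s (s≤s z≤n)) win@(p∈B , noIn)
           (A , (retA@(A⊆B , _ , closed) , minimal) , y∈A) with y ≟ p
  ... | yes y≡p = y≡p
  ... | no y≢p = ⊥-elim (minimal ⁅ p ⁆ ret⁅p⁆ (⁅x⁆⊂p p∈A y∈A (y≢p ∘ sym)))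
    where
    p≻y : T ⊢ p ≻ y
    p≻y with complete p y (y≢p ∘ sym)
    ... | inj₁ p≻y = p≻y
    ... | inj₂ y≻p = ⊥-elim (noIn (y , ∈inNbr⁺ (A⊆B y∈A) y≻p))
    p∈inNbr : p ∈ inNbr T B y
    p∈inNbr = ∈inNbr⁺ p∈B p≻y
    p∈A : p ∈ A
    p∈A = closed y y∈A (p , p∈inNbr) p (winner∈τ (s≤s z≤n) (winner-⊆ inNbr⊆ p∈inNbr win))
    ret⁅p⁆ : RetF T (suc k) B ⁅ p ⁆
    ret⁅p⁆ = retentive-source retA p∈A (proj₂ (winner-⊆ A⊆B p∈A win))

  τ⊆⁅u⁆⇒winner : 2 ≤ k → u ∈ B → (∀ y → TauF T k B y → y ≡ u) → CondorcetWinner B u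
  τ⊆⁅u⁆⇒winner {u = u} {B = B} (s≤s (s≤s z≤n)) u∈B τ⊆⁅u⁆ = u∈B , λ (v , v∈inNbr) →
    τ-nonempty (u , u∈B) λ (y , τy@(A , minA@((_ , _ , closed) , _) , y∈A)) →
    τ-nonempty (v , v∈inNbr) λ (y′ , t′) →
      let u∈A  = subst (_∈ A) (τ⊆⁅u⁆ y τy) y∈A
          y′≡u = τ⊆⁅u⁆ y′ (A , minA , closed u u∈A (v , v∈inNbr) y′ t′)
      in ≻⇒≢ (proj₂ (∈inNbr⁻ {B = B} (τ⊆ t′))) y′≡u

  sole-inNeighbour⇒winner : 2 ≤ k → RetF T k B A → w ∈ A → inNbr T A w ≡ ⁅ u ⁆ →
                            CondorcetWinner (inNbr T B w) u
  sole-inNeighbour⇒winner {B = B} {A = A} {w = w} {u = u} 2≤k retA@(A⊆B , _ , closed) w∈A inNbr≡⁅u⁆ =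
    τ⊆⁅u⁆⇒winner 2≤k u∈inNbr λ y t →
      x∈⁅y⁆⇒x≡y u (subst (y ∈_) inNbr≡⁅u⁆
        (∈inNbr⁺ (closed w w∈A (u , u∈inNbr) y t) (proj₂ (∈inNbr⁻ {B = B} (τ⊆ t)))))
    where
    u∈inNbr : u ∈ inNbr T B w
    u∈inNbr = let (u∈A , u≻w) = inNbr≡⁅⁆⁻ inNbr≡⁅u⁆ in ∈inNbr⁺ (A⊆B u∈A) u≻w

  ¬DominatesTwo⇒winner : (∀ v → ¬ DominatesTwo T v A) → x ∈ A → p ∈ A → T ⊢ p ≻ x →
                         CondorcetWinner (inNbr T ⊤ x) p
  ¬DominatesTwo⇒winner noTwo x∈A p∈A p≻x = ∈inNbr⁺ ∈⊤ p≻x , λ (v , v∈) →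
    let (v∈inNbr , v≻p) = ∈inNbr⁻ v∈
    in noTwo v (_ , _ , ≻⇒≢ p≻x , p∈A , x∈A , v≻p , proj₂ (∈inNbr⁻ {B = ⊤} v∈inNbr))

  SourceFree : Subset n → Set
  SourceFree A = ∀ {x} → x ∈ A → Nonempty (inNbr T A x)

  minimal⇒inNeighbour : MinRetF T k B A → x ∈ A → y ∈ A → x ≢ y → Nonempty (inNbr T A x)
  minimal⇒inNeighbour {A = A} {x = x} (retA , minimal) x∈A y∈A x≢y with nonempty? (inNbr T A x)
  ... | yes ne   = ne
  ... | no noIn = ⊥-elim (minimal ⁅ x ⁆ (retentive-source retA x∈A noIn) (⁅x⁆⊂p x∈A y∈A x≢y))

  directedTriangle⇒sourceFree : DirectedTriangle T A → SourceFree A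
  directedTriangle⇒sourceFree {A = A} (_ , degree) {x} x∈A =
    ∣p∣≢0⇒Nonempty (inNbr T A x) λ ∣inNbr∣≡0 → 1+n≢0 (trans (sym (degree x x∈A)) ∣inNbr∣≡0)

  Cyclic : Fin n → Fin n → Fin n → Set
  Cyclic x y z = T ⊢ x ≻ y × T ⊢ y ≻ z × T ⊢ z ≻ x

  inNeighbour-third : SourceFree A → A ≡ triple v s t →
                      T ⊢ v ≻ s → T ⊢ t ≻ v
  inNeighbour-third sourceFree refl v≻s with sourceFree x∈triple
  ... | u , u∈inNbr = let (u∈A , u≻v) = ∈inNbr⁻ u∈inNbr in subst (λ w → T ⊢ w ≻ _) (≻-third u∈A u≻v v≻s) u≻v

  orientation : a ≢ b → SourceFree (triple a b c) → Cyclic a b c ⊎ Cyclic a c b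
  orientation {a} {b} {c} a≢b sourceFree with complete a b a≢b
  ... | inj₁ a≻b = let c≻a = inNeighbour-third sourceFree refl a≻b
                   in inj₁ (a≻b , inNeighbour-third sourceFree (sym triple-rotate) c≻a , c≻a)
  ... | inj₂ b≻a = let c≻b = inNeighbour-third sourceFree (trans triple-rotate triple-swap) b≻a
                   in inj₂ (inNeighbour-third sourceFree (trans triple-swap triple-rotate) c≻b , c≻b , b≻a)

  module Cycle {x y z : Fin n} (x≻y : T ⊢ x ≻ y) (y≻z : T ⊢ y ≻ z) (z≻x : T ⊢ z ≻ x) where

    private
      R : Subset n
      R = triple x y z

      2≤n : 2 ≤ n
      2≤n = i≢j⇒2≤n (≻⇒≢ x≻y)

    inNbr-x : inNbr T R x ≡ ⁅ z ⁆
    inNbr-x = inNbr≡⁅⁆⁺ z∈triple z≻x λ u∈R u≻x → ≻-third u∈R u≻x x≻y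

    inNbr-y : inNbr T R y ≡ ⁅ x ⁆
    inNbr-y = inNbr≡⁅⁆⁺ x∈triple x≻y λ u∈R u≻y → ≻-third (subst (_ ∈_) triple-rotate u∈R) u≻y y≻z

    inNbr-z : inNbr T R z ≡ ⁅ y ⁆
    inNbr-z = inNbr≡⁅⁆⁺ y∈triple y≻z λ u∈R u≻z → ≻-third (subst (_ ∈_) (sym triple-rotate) u∈R) u≻z z≻x

    sole-inNeighbour : v ∈ R → ∃ λ p → inNbr T R v ≡ ⁅ p ⁆
    sole-inNeighbour v∈R with ∈triple⁻ v∈R
    ... | inj₁ refl        = z , inNbr-x
    ... | inj₂ (inj₁ refl) = x , inNbr-y
    ... | inj₂ (inj₂ refl) = y , inNbr-z

    inNbr≡⁅inNeighbour⁆ : w ∈ R → u ∈ R → T ⊢ u ≻ w → inNbr T R w ≡ ⁅ u ⁆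
    inNbr≡⁅inNeighbour⁆ {w} {u} w∈R u∈R u≻w with sole-inNeighbour w∈R
    ... | p , eq with x∈⁅y⁆⇒x≡y p (subst (u ∈_) eq (∈inNbr⁺ u∈R u≻w))
    ...   | refl = eq

    directedTriangle : DirectedTriangle T R
    directedTriangle = ∣triple∣≡3 (≻⇒≢ x≻y) (≻⇒≢ y≻z) (≻⇒≢ z≻x ∘ sym) , λ v v∈R →
      let (p , eq) = sole-inNeighbour v∈R in trans (cong ∣_∣ eq) (∣⁅x⁆∣≡1 p)

    retentive⇒¬dominates : Retentive T R → u ∈ R → w ∈ R → T ⊢ u ≻ w → T ⊢ v ≻ u → ¬ T ⊢ v ≻ w
    retentive⇒¬dominates retR u∈R w∈R u≻w v≻u v≻w =
      proj₂ (sole-inNeighbour⇒winner 2≤n retR w∈R (inNbr≡⁅inNeighbour⁆ w∈R u∈R u≻w))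
            (_ , ∈inNbr⁺ (∈inNbr⁺ ∈⊤ v≻w) v≻u)

    retentive⇒¬DominatesTwo : Retentive T R → ∀ v → ¬ DominatesTwo T v R
    retentive⇒¬DominatesTwo retR v (u , w , u≢w , u∈R , w∈R , v≻u , v≻w) with complete u w u≢w
    ... | inj₁ u≻w = retentive⇒¬dominates retR u∈R w∈R u≻w v≻u v≻w
    ... | inj₂ w≻u = retentive⇒¬dominates retR w∈R u∈R w≻u v≻w v≻u

    ¬DominatesTwo⇒minimal : (∀ v → ¬ DominatesTwo T v R) → MinRetentive T R
    ¬DominatesTwo⇒minimal noTwo = retR , minimalR
      where
      winner : ∀ {v p} → v ∈ R → inNbr T R v ≡ ⁅ p ⁆ → CondorcetWinner (inNbr T ⊤ v) p
      winner v∈R eq = let (p∈R , p≻v) = inNbr≡⁅⁆⁻ eq in ¬DominatesTwo⇒winner noTwo v∈R p∈R p≻v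

      retR : Retentive T R
      retR = (λ _ → ∈⊤) , (x , x∈triple) , λ v v∈R _ w t →
        let (p , eq) = sole-inNeighbour v∈R
        in subst (_∈ R) (sym (τ⊆winner 2≤n (winner v∈R eq) t)) (proj₁ (inNbr≡⁅⁆⁻ eq))

      minimalR : ∀ A′ → Retentive T A′ → ¬ A′ ⊂ R
      minimalR A′ (_ , (w , w∈A′) , closed) (A′⊆R , v , v∈R , v∉A′) = v∉A′ (triple⊆ x∈A′ y∈A′ z∈A′ v∈R)
        where
        inNeighbour∈A′ : ∀ {u p} → u ∈ A′ → inNbr T R u ≡ ⁅ p ⁆ → p ∈ A′
        inNeighbour∈A′ {u} {p} u∈A′ eq =
          closed u u∈A′ (p , proj₁ win) p (winner∈τ (≤-trans (s≤s z≤n) 2≤n) win)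
          where
          win : CondorcetWinner (inNbr T ⊤ u) p
          win = winner (A′⊆R u∈A′) eq
        x∈A′ : x ∈ A′
        x∈A′ with ∈triple⁻ (A′⊆R w∈A′)
        ... | inj₁ refl        = w∈A′
        ... | inj₂ (inj₁ refl) = inNeighbour∈A′ w∈A′ inNbr-y
        ... | inj₂ (inj₂ refl) = inNeighbour∈A′ (inNeighbour∈A′ w∈A′ inNbr-z) inNbr-y
        z∈A′ : z ∈ A′
        z∈A′ = inNeighbour∈A′ x∈A′ inNbr-x
        y∈A′ : y ∈ A′
        y∈A′ = inNeighbour∈A′ z∈A′ inNbr-z

    characterisation : MinRetentive T R ⇔ (DirectedTriangle T R × ∀ v → ¬ DominatesTwo T v R)
    characterisation = mk⇔ (λ (retR , _) → directedTriangle , retentive⇒¬DominatesTwo retR)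
                           (¬DominatesTwo⇒minimal ∘ proj₂)

  triple-characterisation :
    a ≢ b → SourceFree (triple a b c) →
    MinRetentive T (triple a b c) ⇔
      (DirectedTriangle T (triple a b c) × ∀ v → ¬ DominatesTwo T v (triple a b c))
  triple-characterisation a≢b sourceFree with orientation a≢b sourceFree
  ... | inj₁ (a≻b , b≻c , c≻a) = Cycle.characterisation a≻b b≻c c≻a
  ... | inj₂ (a≻c , c≻b , b≻a) =
    subst (λ R → MinRetentive T R ⇔ (DirectedTriangle T R × ∀ v → ¬ DominatesTwo T v R))
          (sym triple-swap) (Cycle.characterisation a≻c c≻b b≻a)

lemma7 : ∀ {n : ℕ} (T : Tournament n) (a b c : Fin n) →
    a ≢ b → b ≢ c → a ≢ c →
    MinRetentive T (⁅ a ⁆ ∪ ⁅ b ⁆ ∪ ⁅ c ⁆) ⇔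
    (DirectedTriangle T (⁅ a ⁆ ∪ ⁅ b ⁆ ∪ ⁅ c ⁆) ×
    (∀ v → ¬ DominatesTwo T v (⁅ a ⁆ ∪ ⁅ b ⁆ ∪ ⁅ c ⁆)))
lemma7 T a b c a≢b _ a≢c = mk⇔
  (λ minR → to (triple-characterisation T a≢b (minimal⇒sourceFree minR)) minR)
  (λ sides → from (triple-characterisation T a≢b (directedTriangle⇒sourceFree T (proj₁ sides))) sides)
  where
  open Equivalence
  minimal⇒sourceFree : MinRetentive T (triple a b c) → SourceFree T (triple a b c)
  minimal⇒sourceFree minR v∈R =
    let (w , w∈R , v≢w) = triple-other a≢b a≢c v∈R in minimal⇒inNeighbour T minR v∈R w∈R v≢w
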